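{- Let $G$ be a graph and $D$ a super dominating set of $G$ of minimum cardinality. Let $D^*\subseteq D$ with $|D^*|=|\overline{D}|$ be such that for every $u\in\overline{D}$ there exists $u^*\in D^*$ with $N(u^*)\cap\overline{D}=\{u\}$. If $U\subseteq V(G)$ is a twin equivalence class of $G$, then $|U\cap\overline{D}|\le 1$ and $|U\cap D^*|\le 1$.
   Context: All graphs are finite, simple and undirected. For a vertex $v$, $N(v)$ is its set of neighbours and $N[v]=N(v)\cup\{v\}$; for $D\subseteq V(G)$, $\overline{D}=V(G)\setminus D$. A set $D\subseteq V(G)$ is a super dominating set of $G$ if for every $u\in\overline{D}$ there exists $v\in D$ such that $N(v)\cap\overline{D}=\{u\}$. The twin equivalence relation on $V(G)$ is defined by $x\,\mathcal{R}\,y$ iff $N[x]=N[y]$ or $N(x)=N(y)$; its equivalence classes are the twin equivalence classes. -}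

module Defs where

open import Data.Nat using (ℕ; _≤_)
open import Data.Bool using (Bool; true; false)
open import Data.Fin using (Fin)
open import Data.Fin.Subset using (Subset; _∈_; _∉_; _⊆_; ∁; _∩_; _∪_; ⁅_⁆; ∣_∣)
open import Data.Vec using (tabulate)
open import Data.Product using (Σ; ∃; _×_; _,_)
open import Data.Sum using (_⊎_)
open import Relation.Binary.PropositionalEquality using (_≡_)

record Graph (n : ℕ) : Set where
  field
    adj   : Fin n → Fin n → Bool
    sym   : ∀ x y → adj x y ≡ adj y x
    irrefl : ∀ x → adj x x ≡ false

open Graph public

N : ∀ {n} → Graph n → Fin n → Subset n
N G v = tabulate (adj G v)

N[_] : ∀ {n} → Graph n → Fin n → Subset n
N[ G ] v = N G v ∪ ⁅ v ⁆

SuperDominating : ∀ {n} → Graph n → Subset n → Set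
SuperDominating G D = ∀ u → u ∈ ∁ D → Σ _ λ v → v ∈ D × (N G v ∩ ∁ D ≡ ⁅ u ⁆)

MinSuperDominating : ∀ {n} → Graph n → Subset n → Set
MinSuperDominating {n} G D =
  SuperDominating G D × (∀ (D′ : Subset n) → SuperDominating G D′ → ∣ D ∣ ≤ ∣ D′ ∣)

Twin : ∀ {n} → Graph n → Fin n → Fin n → Set
Twin G x y = (N[ G ] x ≡ N[ G ] y) ⊎ (N G x ≡ N G y)

TwinClass : ∀ {n} → Graph n → Subset n → Set
TwinClass {n} G U = Σ (Fin n) λ x → ∀ (y : Fin n) → (y ∈ U → Twin G x y) × (Twin G x y → y ∈ U)

-- Twins a, b have the same neighbours apart from possibly each other. Two twins
-- outside D are therefore both adjacent to the private-neighbour witness of one of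
-- them, so they coincide. Choosing a partner u* ∈ D* for each u ∈ D̄ is injective,
-- as u is the only neighbour of u* outside D, hence onto D* since |D*| = |D̄|; two
-- twins in D* are then partners of a common vertex of D̄ and again coincide.
module Submission where

open import Defs hiding (sym)
open import Data.Nat using (ℕ; zero; suc; pred; _≤_; z≤n; s≤s)
open import Data.Nat.Properties using (≤-trans; ≤-reflexive; ≤-<-trans; <⇒≱)
open import Data.Bool using (true)
open import Data.Fin using (Fin)
open import Data.Fin.Properties using (any?; _≟_)
open import Data.Fin.Subset using (Subset; _∈_; _∉_; _⊆_; ∁; _∩_; ⁅_⁆; ∣_∣; _─_; _-_; Empty; Nonempty; inside; outside)
open import Data.Fin.Subset.Properties
open import Data.Vec.Base using (_∷_; here; there)
open import Data.Vec.Properties using ([]=⇒lookup; lookup⇒[]=; lookup∘tabulate)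
open import Data.Product using (Σ; _×_; _,_; proj₁; proj₂; ∃)
open import Data.Sum using (inj₁; inj₂)
open import Relation.Nullary using (yes; no; contradiction)
open import Relation.Nullary.Decidable using (_×-dec_)
open import Relation.Binary.PropositionalEquality
  using (_≡_; _≢_; refl; sym; trans; cong; subst; module ≡-Reasoning)

module _ {n : ℕ} where

  Empty⇒∣p∣≡0 : {p : Subset n} → Empty p → ∣ p ∣ ≡ 0
  Empty⇒∣p∣≡0 p-empty = trans (cong ∣_∣ (Empty-unique p-empty)) (∣⊥∣≡0 n)

  ∣p∣≡suc⇒Nonempty : ∀ {k} (p : Subset n) → ∣ p ∣ ≡ suc k → Nonempty p
  ∣p∣≡suc⇒Nonempty p ∣p∣≡1+k with nonempty? p
  ... | yes p-nonempty = p-nonempty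
  ... | no p-empty with trans (sym (Empty⇒∣p∣≡0 p-empty)) ∣p∣≡1+k
  ...   | ()

  all-equal⇒∣p∣≤1 : (p : Subset n) → (∀ {x y} → x ∈ p → y ∈ p → x ≡ y) → ∣ p ∣ ≤ 1
  all-equal⇒∣p∣≤1 p all-equal with nonempty? p
  ... | no p-empty = ≤-trans (≤-reflexive (Empty⇒∣p∣≡0 p-empty)) z≤n
  ... | yes (x , x∈p) = ≤-trans (p⊆q⇒∣p∣≤∣q∣ p⊆⁅x⁆) (≤-reflexive (∣⁅x⁆∣≡1 x))
    where
    p⊆⁅x⁆ : p ⊆ ⁅ x ⁆
    p⊆⁅x⁆ y∈p = subst (_∈ ⁅ x ⁆) (all-equal x∈p y∈p) (x∈⁅x⁆ x)

x∈p⇒∣p∣≡1+∣p-x∣ : ∀ {n} {x : Fin n} (p : Subset n) → x ∈ p → ∣ p ∣ ≡ suc ∣ p - x ∣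
x∈p⇒∣p∣≡1+∣p-x∣ (inside ∷ p) here = cong suc (cong ∣_∣ (sym (p─⊥≡p p)))
x∈p⇒∣p∣≡1+∣p-x∣ (inside ∷ p) (there x∈p) = cong suc (x∈p⇒∣p∣≡1+∣p-x∣ p x∈p)
x∈p⇒∣p∣≡1+∣p-x∣ (outside ∷ p) (there x∈p) = x∈p⇒∣p∣≡1+∣p-x∣ p x∈p

x∈p─q⇒x∉q : ∀ {n} {x : Fin n} (p q : Subset n) → x ∈ p ─ q → x ∉ q
x∈p─q⇒x∉q (_ ∷ p) (inside ∷ q) () here
x∈p─q⇒x∉q (_ ∷ p) (_ ∷ q) (there x∈p─q) (there x∈q) = x∈p─q⇒x∉q p q x∈p─q x∈q

x∈p-y⇒x≢y : ∀ {n} {x y : Fin n} (p : Subset n) → x ∈ p - y → x ≢ y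
x∈p-y⇒x≢y {y = y} p x∈p-y refl = x∈p─q⇒x∉q p ⁅ y ⁆ x∈p-y (x∈⁅x⁆ y)

x∈p∧y∈∁p⇒x≢y : ∀ {n} {x y : Fin n} {p : Subset n} → x ∈ p → y ∈ ∁ p → x ≢ y
x∈p∧y∈∁p⇒x≢y x∈p y∈∁p refl = x∈p⇒x∉∁p x∈p y∈∁p

choice : ∀ {n} {p : Subset n} {P : Fin n → Fin n → Set}
  → (∀ x → x ∈ p → ∃ (P x)) → ∃ λ (f : Fin n → Fin n) → ∀ {x} → x ∈ p → P x (f x)
choice {n} {p} {P} chosen = f , f-spec
  where
  f : Fin n → Fin n
  f x with x ∈? p
  ... | yes x∈p = proj₁ (chosen x x∈p)
  ... | no _ = x

  f-spec : ∀ {x} → x ∈ p → P x (f x)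
  f-spec {x} x∈p with x ∈? p
  ... | yes x∈p′ = proj₂ (chosen x x∈p′)
  ... | no x∉p = contradiction x∈p x∉p

module _ {n : ℕ} (f : Fin n → Fin n) where

  MapsTo : Subset n → Subset n → Set
  MapsTo p q = ∀ {x} → x ∈ p → f x ∈ q

  InjectiveOn : Subset n → Set
  InjectiveOn p = ∀ {x y} → x ∈ p → y ∈ p → f x ≡ f y → x ≡ y

  injectiveOn⇒∣p∣≤∣q∣ : ∀ {p q} → MapsTo p q → InjectiveOn p → ∣ p ∣ ≤ ∣ q ∣
  injectiveOn⇒∣p∣≤∣q∣ {p} = count ∣ p ∣ refl
    where
    count : ∀ k {p q} → ∣ p ∣ ≡ k → MapsTo p q → InjectiveOn p → k ≤ ∣ q ∣
    count zero _ _ _ = z≤n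
    count (suc k) {p} {q} ∣p∣≡1+k into injective with ∣p∣≡suc⇒Nonempty p ∣p∣≡1+k
    ... | x , x∈p = ≤-trans (s≤s rest) (≤-reflexive (sym (x∈p⇒∣p∣≡1+∣p-x∣ q (into x∈p))))
      where
      y∈p-x⇒y∈p : ∀ {y} → y ∈ p - x → y ∈ p
      y∈p-x⇒y∈p = p─q⊆p p ⁅ x ⁆

      rest : k ≤ ∣ q - f x ∣
      rest = count k
        (cong pred (trans (sym (x∈p⇒∣p∣≡1+∣p-x∣ p x∈p)) ∣p∣≡1+k))
        (λ y∈p-x → x∈p∧x≢y⇒x∈p-y (into (y∈p-x⇒y∈p y∈p-x))
           (λ fy≡fx → x∈p-y⇒x≢y p y∈p-x (injective (y∈p-x⇒y∈p y∈p-x) x∈p fy≡fx)))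
        (λ y∈ z∈ → injective (y∈p-x⇒y∈p y∈) (y∈p-x⇒y∈p z∈))

  injectiveOn⇒onto : ∀ {p q} → MapsTo p q → InjectiveOn p → ∣ q ∣ ≤ ∣ p ∣
    → ∀ {y} → y ∈ q → ∃ λ x → x ∈ p × f x ≡ y
  injectiveOn⇒onto {p} {q} into injective ∣q∣≤∣p∣ {y} y∈q
    with any? (λ x → (x ∈? p) ×-dec (f x ≟ y))
  ... | yes preimage = preimage
  ... | no no-preimage = contradiction ∣q∣≤∣p∣ (<⇒≱ (≤-<-trans ∣p∣≤∣q-y∣ (x∈p⇒∣p-x∣<∣p∣ y∈q)))
    where
    ∣p∣≤∣q-y∣ : ∣ p ∣ ≤ ∣ q - y ∣
    ∣p∣≤∣q-y∣ = injectiveOn⇒∣p∣≤∣q∣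
      (λ {x} x∈p → x∈p∧x≢y⇒x∈p-y (into x∈p) (λ fx≡y → no-preimage (x , x∈p , fx≡y)))
      injective


module _ {n : ℕ} (G : Graph n) where

  adj⇒∈N : ∀ {x y} → adj G x y ≡ true → y ∈ N G x
  adj⇒∈N {x} {y} x~y = lookup⇒[]= y (N G x) (trans (lookup∘tabulate (adj G x) y) x~y)

  ∈N⇒adj : ∀ {x y} → y ∈ N G x → adj G x y ≡ true
  ∈N⇒adj {x} {y} y∈Nx = trans (sym (lookup∘tabulate (adj G x) y)) ([]=⇒lookup y∈Nx)

  ∈N-sym : ∀ {x y} → y ∈ N G x → x ∈ N G y
  ∈N-sym {x} {y} y∈Nx = adj⇒∈N (trans (Graph.sym G y x) (∈N⇒adj y∈Nx))

  x∉Nx : ∀ {x} → x ∉ N G x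
  x∉Nx {x} x∈Nx with trans (sym (Graph.irrefl G x)) (∈N⇒adj x∈Nx)
  ... | ()

  x∈N[x] : ∀ x → x ∈ N[ G ] x
  x∈N[x] x = q⊆p∪q (N G x) ⁅ x ⁆ (x∈⁅x⁆ x)

  ∈N⇒∈N[] : ∀ {x y} → y ∈ N G x → y ∈ N[ G ] x
  ∈N⇒∈N[] {x} = p⊆p∪q ⁅ x ⁆

  ∈N[]⇒∈N : ∀ {x y} → y ∈ N[ G ] x → y ≢ x → y ∈ N G x
  ∈N[]⇒∈N {x} y∈N[x] y≢x with x∈p∪q⁻ (N G x) ⁅ x ⁆ y∈N[x]
  ... | inj₁ y∈Nx = y∈Nx
  ... | inj₂ y∈⁅x⁆ = contradiction (x∈⁅y⁆⇒x≡y x y∈⁅x⁆) y≢x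

  N[]≡⇒∈N : ∀ {x y} → N[ G ] x ≡ N[ G ] y → x ≢ y → y ∈ N G x
  N[]≡⇒∈N {x} {y} N[x]≡N[y] x≢y =
    ∈N[]⇒∈N (subst (y ∈_) (sym N[x]≡N[y]) (x∈N[x] y)) (λ y≡x → x≢y (sym y≡x))

  Twin-sym : ∀ {x y} → Twin G x y → Twin G y x
  Twin-sym (inj₁ N[x]≡N[y]) = inj₁ (sym N[x]≡N[y])
  Twin-sym (inj₂ Nx≡Ny) = inj₂ (sym Nx≡Ny)

  -- For distinct x, y, z the hypotheses are contradictory:
  -- z ∈ N(x) ⊆ N[x] = N[y] forces z ∈ N(y) = N(z).
  N[]≡∧N≡⇒Twin : ∀ {x y z} → N[ G ] x ≡ N[ G ] y → N G y ≡ N G z → Twin G x z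
  N[]≡∧N≡⇒Twin {x} {y} {z} N[x]≡N[y] Ny≡Nz with x ≟ y | y ≟ z
  ... | yes refl | _ = inj₂ Ny≡Nz
  ... | _ | yes refl = inj₁ N[x]≡N[y]
  ... | no x≢y | no y≢z = contradiction z∈Nz x∉Nx
    where
    z∈Nx : z ∈ N G x
    z∈Nx = ∈N-sym (subst (x ∈_) Ny≡Nz (∈N-sym (N[]≡⇒∈N N[x]≡N[y] x≢y)))

    z∈Nz : z ∈ N G z
    z∈Nz = subst (z ∈_) Ny≡Nz
      (∈N[]⇒∈N (subst (z ∈_) N[x]≡N[y] (∈N⇒∈N[] z∈Nx)) (λ z≡y → y≢z (sym z≡y)))

  Twin-trans : ∀ {x y z} → Twin G x y → Twin G y z → Twin G x z
  Twin-trans (inj₁ N[x]≡N[y]) (inj₁ N[y]≡N[z]) = inj₁ (trans N[x]≡N[y] N[y]≡N[z])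
  Twin-trans (inj₂ Nx≡Ny) (inj₂ Ny≡Nz) = inj₂ (trans Nx≡Ny Ny≡Nz)
  Twin-trans (inj₁ N[x]≡N[y]) (inj₂ Ny≡Nz) = N[]≡∧N≡⇒Twin N[x]≡N[y] Ny≡Nz
  Twin-trans (inj₂ Nx≡Ny) (inj₁ N[y]≡N[z]) =
    Twin-sym (N[]≡∧N≡⇒Twin (sym N[y]≡N[z]) (sym Nx≡Ny))

  TwinClass⇒Twin : ∀ {U x y} → TwinClass G U → x ∈ U → y ∈ U → Twin G x y
  TwinClass⇒Twin (c , U≡class) x∈U y∈U =
    Twin-trans (Twin-sym (proj₁ (U≡class _) x∈U)) (proj₁ (U≡class _) y∈U)

  Twin⇒∈N : ∀ {x y z} → Twin G x y → z ≢ y → z ∈ N G x → z ∈ N G y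
  Twin⇒∈N (inj₁ N[x]≡N[y]) z≢y z∈Nx = ∈N[]⇒∈N (subst (_ ∈_) N[x]≡N[y] (∈N⇒∈N[] z∈Nx)) z≢y
  Twin⇒∈N (inj₂ Nx≡Ny) _ z∈Nx = subst (_ ∈_) Nx≡Ny z∈Nx

module _ {n : ℕ} (G : Graph n) (D : Subset n) where

  PrivateNeighbour : Fin n → Fin n → Set
  PrivateNeighbour v u = N G v ∩ ∁ D ≡ ⁅ u ⁆

  PrivateNeighbour⇒∈N∩∁ : ∀ {v u} → PrivateNeighbour v u → u ∈ N G v × u ∈ ∁ D
  PrivateNeighbour⇒∈N∩∁ {v} {u} private-u =
    x∈p∩q⁻ (N G v) (∁ D) (subst (u ∈_) (sym private-u) (x∈⁅x⁆ u))

  PrivateNeighbour-unique : ∀ {v u w} → PrivateNeighbour v u → w ∈ N G v → w ∈ ∁ D → w ≡ u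
  PrivateNeighbour-unique {u = u} private-u w∈Nv w∈∁D =
    x∈⁅y⁆⇒x≡y u (subst (_ ∈_) private-u (x∈p∩q⁺ (w∈Nv , w∈∁D)))

  SuperDominating⇒twins∈∁D-≡ : SuperDominating G D
    → ∀ {a b} → Twin G a b → a ∈ ∁ D → b ∈ ∁ D → a ≡ b
  SuperDominating⇒twins∈∁D-≡ superDominating {a} {b} a~b a∈∁D b∈∁D
    with superDominating a a∈∁D
  ... | v , v∈D , private-a = sym (PrivateNeighbour-unique private-a (∈N-sym G v∈Nb) b∈∁D)
    where
    v∈Nb : v ∈ N G b
    v∈Nb = Twin⇒∈N G a~b (x∈p∧y∈∁p⇒x≢y v∈D b∈∁D)
      (∈N-sym G (proj₁ (PrivateNeighbour⇒∈N∩∁ private-a)))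

  Twin⇒PrivateNeighbour-≡ : ∀ {a b u w} → Twin G a b → b ∈ D
    → PrivateNeighbour a u → PrivateNeighbour b w → u ≡ w
  Twin⇒PrivateNeighbour-≡ a~b b∈D private-u private-w
    with PrivateNeighbour⇒∈N∩∁ private-u
  ... | u∈Na , u∈∁D = PrivateNeighbour-unique private-w
    (Twin⇒∈N G a~b (λ u≡b → x∈p∧y∈∁p⇒x≢y b∈D u∈∁D (sym u≡b)) u∈Na) u∈∁D

  partners-onto : ∀ {D*} → ∣ D* ∣ ≤ ∣ ∁ D ∣
    → (∀ u → u ∈ ∁ D → Σ (Fin n) λ u* → u* ∈ D* × PrivateNeighbour u* u)
    → ∃ λ (partner : Fin n → Fin n)
        → (∀ {u} → u ∈ ∁ D → PrivateNeighbour (partner u) u)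
        × (∀ {a} → a ∈ D* → ∃ λ u → u ∈ ∁ D × partner u ≡ a)
  partners-onto {D*} ∣D*∣≤∣∁D∣ partners with choice partners
  ... | partner , partner-spec =
    partner , (λ u∈∁D → proj₂ (partner-spec u∈∁D)) ,
    injectiveOn⇒onto partner (λ u∈∁D → proj₁ (partner-spec u∈∁D)) injective ∣D*∣≤∣∁D∣
    where
    injective : InjectiveOn partner (∁ D)
    injective {u} {w} u∈∁D w∈∁D partner-u≡partner-w =
      PrivateNeighbour-unique (proj₂ (partner-spec w∈∁D))
        (subst (λ v → u ∈ N G v) partner-u≡partner-w
          (proj₁ (PrivateNeighbour⇒∈N∩∁ (proj₂ (partner-spec u∈∁D)))))
        u∈∁D

  twins∈D*-≡ : ∀ {D*} → D* ⊆ D → ∣ D* ∣ ≤ ∣ ∁ D ∣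
    → (∀ u → u ∈ ∁ D → Σ (Fin n) λ u* → u* ∈ D* × PrivateNeighbour u* u)
    → ∀ {a b} → Twin G a b → a ∈ D* → b ∈ D* → a ≡ b
  twins∈D*-≡ D*⊆D ∣D*∣≤∣∁D∣ partners {a} {b} a~b a∈D* b∈D*
    with partners-onto ∣D*∣≤∣∁D∣ partners
  ... | partner , partner-private , onto
    with onto a∈D* | onto b∈D*
  ... | u , u∈∁D , partner-u≡a | w , w∈∁D , partner-w≡b = begin
    a          ≡⟨ sym partner-u≡a ⟩
    partner u  ≡⟨ cong partner u≡w ⟩
    partner w  ≡⟨ partner-w≡b ⟩
    b          ∎
    where
    open ≡-Reasoning

    u≡w : u ≡ w
    u≡w = Twin⇒PrivateNeighbour-≡ a~b (D*⊆D b∈D*)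
      (subst (λ v → PrivateNeighbour v u) partner-u≡a (partner-private u∈∁D))
      (subst (λ v → PrivateNeighbour v w) partner-w≡b (partner-private w∈∁D))

lemma9 : ∀ {n} (G : Graph n) (D D* : Subset n)
    → MinSuperDominating G D
    → D* ⊆ D
    → ∣ D* ∣ ≡ ∣ ∁ D ∣
    → (∀ u → u ∈ ∁ D → Σ (Fin n) λ u* → u* ∈ D* × (N G u* ∩ ∁ D ≡ ⁅ u ⁆))
    → ∀ (U : Subset n) → TwinClass G U
    → (∣ U ∩ ∁ D ∣ ≤ 1) × (∣ U ∩ D* ∣ ≤ 1)
lemma9 G D D* (superDominating , _) D*⊆D ∣D*∣≡∣∁D∣ partners U U-class =
  all-equal⇒∣p∣≤1 (U ∩ ∁ D) (λ a∈ b∈ → within (∁ D)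
    (SuperDominating⇒twins∈∁D-≡ G D superDominating) a∈ b∈) ,
  all-equal⇒∣p∣≤1 (U ∩ D*) (λ a∈ b∈ → within D*
    (twins∈D*-≡ G D D*⊆D (≤-reflexive ∣D*∣≡∣∁D∣) partners) a∈ b∈)
  where
  within : ∀ S → (∀ {a b} → Twin G a b → a ∈ S → b ∈ S → a ≡ b)
    → ∀ {a b} → a ∈ U ∩ S → b ∈ U ∩ S → a ≡ b
  within S twins-≡ a∈U∩S b∈U∩S with x∈p∩q⁻ U S a∈U∩S | x∈p∩q⁻ U S b∈U∩S
  ... | a∈U , a∈S | b∈U , b∈S = twins-≡ (TwinClass⇒Twin G U-class a∈U b∈U) a∈S b∈S
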